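{- Let $G=(V,E)$ with weights $x:E\to\mathbb{R}_{\ge0}$ be fractionally 2-edge-connected, let $\eta>0$, and let $\mathcal C$ be a connected component of the family of $\eta$-near minimum cuts of $G$. Let $B$ be a set of atoms of $\mathcal C$ (identified with the union of these atoms) which is an $\eta$-near minimum cut and satisfies $1<|B|<|\mathcal A(\mathcal C)|-1$, where $|B|$ is the number of atoms in $B$. Then $B\in\mathcal C$.
   Context: $G$ is fractionally 2-edge-connected if $x(\delta(S))\ge 2$ for all $\emptyset\ne S\subsetneq V$, where $\delta(S)$ is the set of edges with exactly one endpoint in $S$ and $x(F)=\sum_{e\in F}x_e$. A cut is an unordered bipartition $\{S,V\setminus S\}$ with $\emptyset\ne S\subsetneq V$; it is an $\eta$-near minimum cut if $x(\delta(S))<2+\eta$. Two cuts $\{A,\bar A\}$, $\{B,\bar B\}$ cross if $A\cap B$, $A\setminus B$, $B\setminus A$, $V\setminus(A\cup B)$ are all nonempty. Form the graph whose vertices are the $\eta$-near minimum cuts and where two cuts are adjacent iff they cross; a connected component $\mathcal C$ is a maximal connected set of cuts in this graph. The atoms $\mathcal A(\mathcal C)$ are the parts of the coarsest partition of $V$ such that every atom lies entirely on one side of every cut in $\mathcal C$. -}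

module Defs where

open import Level using (Level; _⊔_) renaming (suc to lsuc)
open import Data.Nat using (ℕ; zero; suc)
open import Data.Fin using (Fin)
import Data.Fin as Fin
open import Data.Bool using (Bool; true; false; _xor_; if_then_else_)
open import Data.Vec using (lookup)
open import Data.Fin.Subset using (Subset; _∈_; _∉_; ∁; _∩_; _∪_; Nonempty)
open import Data.Product using (_×_; ∃; _,_)
open import Data.Sum using (_⊎_)
open import Relation.Nullary using (¬_)
open import Relation.Binary using (Rel; IsTotalOrder)
open import Relation.Binary.Construct.Closure.ReflexiveTransitive using (Star)
open import Algebra.Bundles using (CommutativeRing)

-- Ordered commutative rings (weights live here; ℝ is an instance).

record OrderedCommRing (c ℓ₁ ℓ₂ : Level) : Set (lsuc (c ⊔ ℓ₁ ⊔ ℓ₂)) where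
  field
    commutativeRing : CommutativeRing c ℓ₁
  open CommutativeRing commutativeRing public
  infix 4 _≤_ _<_
  field
    _≤_          : Rel Carrier ℓ₂
    isTotalOrder : IsTotalOrder _≈_ _≤_
    +-mono-≤     : ∀ {x y} z → x ≤ y → x + z ≤ y + z
    *-nonneg     : ∀ {x y} → 0# ≤ x → 0# ≤ y → 0# ≤ x * y

  _<_ : Rel Carrier (ℓ₁ ⊔ ℓ₂)
  x < y = x ≤ y × ¬ (x ≈ y)

  2# : Carrier
  2# = 1# + 1#

-- Weighted (multi)graphs on vertex set Fin n with edge set Fin m;
-- edge e has endpoints end₁ e and end₂ e, weight x e.

module _ {c ℓ₁ ℓ₂ : Level} (R : OrderedCommRing c ℓ₁ ℓ₂) where
  open OrderedCommRing R using (Carrier; 0#; 1#; _+_; _≤_; _<_; 2#)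

  sumFin : ∀ m → (Fin m → Carrier) → Carrier
  sumFin zero    f = 0#
  sumFin (suc m) f = f Fin.zero + sumFin m (λ i → f (Fin.suc i))

  module _ {n m : ℕ} (end₁ end₂ : Fin m → Fin n) (x : Fin m → Carrier) where

    cutWeight : Subset n → Carrier
    cutWeight S = sumFin m (λ e →
      if lookup S (end₁ e) xor lookup S (end₂ e) then x e else 0#)

    IsCut : Subset n → Set
    IsCut S = Nonempty S × Nonempty (∁ S)

    FractionallyTwoEdgeConnected : Set ℓ₂
    FractionallyTwoEdgeConnected = ∀ S → IsCut S → 2# ≤ cutWeight S

    NearMin : Carrier → Subset n → Set (ℓ₁ ⊔ ℓ₂)
    NearMin η S = IsCut S × cutWeight S < 2# + η

    Cross : Subset n → Subset n → Set
    Cross A B = Nonempty (A ∩ B) × Nonempty (A ∩ ∁ B)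
              × Nonempty (B ∩ ∁ A) × Nonempty (∁ (A ∪ B))

    CrossEdge : Carrier → Subset n → Subset n → Set (ℓ₁ ⊔ ℓ₂)
    CrossEdge η A B = NearMin η A × NearMin η B × Cross A B

    -- The cut {T, V∖T} lies in the connected component (of the crossing
    -- graph on η-near minimum cuts) containing the cut {S₀, V∖S₀}:
    -- it is reachable by a path of crossing near-min cuts from S₀,
    -- where T may be represented by either side.
    InComponent : Carrier → Subset n → Subset n → Set (ℓ₁ ⊔ ℓ₂)
    InComponent η S₀ T = Star (CrossEdge η) S₀ T ⊎ Star (CrossEdge η) S₀ (∁ T)

    SameAtom : Carrier → Subset n → Fin n → Fin n → Set (ℓ₁ ⊔ ℓ₂)
    SameAtom η S₀ u v = ∀ T → InComponent η S₀ T → (u ∈ T → v ∈ T) × (v ∈ T → u ∈ T)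

    UnionOfAtoms : Carrier → Subset n → Subset n → Set (ℓ₁ ⊔ ℓ₂)
    UnionOfAtoms η S₀ B = ∀ u v → SameAtom η S₀ u v → u ∈ B → v ∈ B

    AtLeastTwoAtomsIn : Carrier → Subset n → Subset n → Set (ℓ₁ ⊔ ℓ₂)
    AtLeastTwoAtomsIn η S₀ B = ∃ λ u → ∃ λ v → u ∈ B × v ∈ B × ¬ SameAtom η S₀ u v

{-# OPTIONS --safe #-}
module Submission where

-- If B were not in the component 𝒞 of S₀, no cut of 𝒞 would cross B (it would then be
-- adjacent to B).  A cut not crossing B has a side inside B or inside V ∖ B; and if T has a
-- side inside D and T′ crosses T, then some side of T′ meets it, so no side of T′ lies in
-- V ∖ D.  Starting from S₀, every cut of 𝒞 thus has a side inside one fixed D ∈ {B, V ∖ B},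
-- so no cut of 𝒞 separates two vertices of the other side of B: that side is a single atom,
-- contrary to the hypothesis.
--
-- This only yields ¬ ¬ (S₀ reaches B), as x(δ(S)) < 2 + η is not decidable over an ordered
-- ring.  Reachability through the vertices below a strict weight threshold is nevertheless
-- stable: discard the heaviest candidate cuts one at a time while B stays reachable among
-- the rest.  Once it does not, every path of near minimum cuts would have to use the last
-- cut discarded (or one at least as heavy), so that cut, and with it every remaining
-- candidate, lies below the threshold.

open import Defs
open import Level using (Level; _⊔_)
open import Data.Bool.Properties using () renaming (_≟_ to _≟ᴮ_)
open import Data.Nat using (ℕ)
import Data.Nat as ℕ
open import Data.Nat.Induction using (<-wellFounded)
open import Data.Fin using (Fin)
open import Data.Fin.Subset using (Subset; ∁; _∩_; _∪_; Nonempty; inside; outside)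
open import Data.Fin.Subset.Properties
  using ( nonempty?; x∈p∩q⁺; x∈p∩q⁻; x∈p∪q⁺; x∈p∪q⁻
        ; x∈p⇒x∉∁p; x∈∁p⇒x∉p; x∉∁p⇒x∈p; x∉p⇒x∈∁p; p⊆q⇒∁p⊇∁q )
open import Data.Product using (_×_; _,_; proj₁; proj₂)
open import Data.Sum using (_⊎_; inj₁; inj₂; [_,_]′; swap)
open import Data.Empty using (⊥-elim)
open import Data.List using (List; []; _∷_; [_]; _++_; map; length; filter)
open import Data.List.Properties using (filter-notAll)
open import Data.List.Relation.Unary.Any using (Any; here; there; any?; satisfied)
open import Data.List.Relation.Unary.All as All using (All; []; _∷_)
open import Data.List.Relation.Unary.All.Properties using (all-filter; filter⁺)
open import Data.List.Membership.Propositional.Properties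
  using (∈-filter⁺; ∈-filter⁻; ∈-map⁺; ∈-++⁺ˡ; ∈-++⁺ʳ)
import Data.List.Extrema as Extrema
import Data.Vec as Vec
open import Data.Vec.Properties using (≡-dec)
open import Function using (_∘_; _on_; id)
open import Induction.WellFounded using (Acc; acc)
open import Relation.Binary using (Rel; Decidable; DecidableEquality; TotalOrder; _⇒_)
import Relation.Binary.Construct.NonStrictToStrict as NonStrictToStrict
open import Relation.Binary.Construct.On using (wellFounded)
open import Relation.Binary.Construct.Closure.ReflexiveTransitive as Star
  using (Star; ε; _◅_; _◅◅_)
open import Relation.Binary.PropositionalEquality using (refl)
open import Relation.Nullary using (¬_; Dec; yes; no; ¬?; _×-dec_; Stable)
open import Relation.Nullary.Decidable using (decidable-stable)
import Relation.Nullary.Decidable as Dec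
open import Relation.Unary using (Pred)
import Relation.Unary as U

Star-invariant : ∀ {a ℓ p} {A : Set a} {R : Rel A ℓ} {P : Pred A p} {s} → P s →
  (∀ {X Y} → Star R s X → R X Y → P X → P Y) → ∀ {t} → Star R s t → P t
Star-invariant {R = R} {P} {s} Ps step = go ε Ps
  where
  go : ∀ {X t} → Star R s X → P X → Star R X t → P t
  go pre PX ε        = PX
  go pre PX (r ◅ rs) = go (pre ◅◅ r ◅ ε) (step pre r PX) rs

module FiniteReachability {a ℓ} {A : Set a} (_≟_ : DecidableEquality A)
                          {_⟶_ : Rel A ℓ} (_⟶?_ : Decidable _⟶_) where

  open import Data.List.Membership.Propositional using (_∈_; lose)
  open import Data.List.Membership.DecPropositional _≟_ using (_∈?_)

  Within : List A → Rel A (a ⊔ ℓ)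
  Within L X Y = X ⟶ Y × Y ∈ L

  _∖_ : List A → A → List A
  L ∖ Y = filter (λ Z → ¬? (Z ≟ Y)) L

  ∖-shorter : ∀ {L Y} → Y ∈ L → length (L ∖ Y) ℕ.< length L
  ∖-shorter {L} {Y} Y∈L = filter-notAll (λ Z → ¬? (Z ≟ Y)) L (lose Y∈L λ Y≢Y → Y≢Y refl)

  Within-∖ : ∀ {L} Y → Star (Within (L ∖ Y)) ⇒ Star (Within L)
  Within-∖ Y = Star.map λ (X⟶Z , Z∈L∖Y) → X⟶Z , proj₁ (∈-filter⁻ (λ Z → ¬? (Z ≟ Y)) Z∈L∖Y)

  Within-last-visit : ∀ {L X t} Y → Star (Within L) X t →
    Star (Within (L ∖ Y)) X t ⊎ Star (Within (L ∖ Y)) Y t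
  Within-last-visit Y ε = inj₁ ε
  Within-last-visit Y (_◅_ {j = Z} (X⟶Z , Z∈L) p) with Within-last-visit Y p
  ... | inj₂ q = inj₂ q
  ... | inj₁ q with Z ≟ Y
  ...   | yes refl = inj₂ q
  ...   | no Z≢Y   = inj₁ ((X⟶Z , ∈-filter⁺ (λ Z → ¬? (Z ≟ Y)) Z∈L Z≢Y) ◅ q)

  reachable? : ∀ L s t → Dec (Star (Within L) s t)
  reachable? L = search L (wellFounded length <-wellFounded L)
    where
    search : ∀ L → Acc (ℕ._<_ on length) L → ∀ s t → Dec (Star (Within L) s t)
    search L (acc rs) s t with s ≟ t
    ... | yes refl = yes ε
    ... | no s≢t   = Dec.map′ viaFirstStep firstStep (any? firstStep? L)
      where
      FirstStep : Pred A _
      FirstStep Y = Y ∈ L × s ⟶ Y × Star (Within (L ∖ Y)) Y t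

      firstStep? : U.Decidable FirstStep
      firstStep? Y with Y ∈? L
      ... | no Y∉L  = no (Y∉L ∘ proj₁)
      ... | yes Y∈L = Dec.map′ (Y∈L ,_) proj₂
                        (s ⟶? Y ×-dec search (L ∖ Y) (rs (∖-shorter Y∈L)) Y t)

      viaFirstStep : Any FirstStep L → Star (Within L) s t
      viaFirstStep any with satisfied any
      ... | Y , Y∈L , s⟶Y , p = (s⟶Y , Y∈L) ◅ Within-∖ Y p

      firstStep : Star (Within L) s t → Any FirstStep L
      firstStep ε = ⊥-elim (s≢t refl)
      firstStep ((s⟶Y , Y∈L) ◅ p) = lose Y∈L (Y∈L , s⟶Y , [ id , id ]′ (Within-last-visit _ p))

module SublevelReachability
  {b ℓ₁ ℓ₂} (O : TotalOrder b ℓ₁ ℓ₂)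
  {a ℓ q} {A : Set a} (_≟_ : DecidableEquality A)
  {_⟶_ : Rel A ℓ} (_⟶?_ : Decidable _⟶_)
  {Q : Pred A q} (Q? : U.Decidable Q) (w : A → TotalOrder.Carrier O) (K : TotalOrder.Carrier O)
  where

  open import Data.List.Membership.Propositional using (_∈_)
  open TotalOrder O using (_≈_; _≤_; total; antisym; trans; ≤-respˡ-≈)
  open NonStrictToStrict _≈_ _≤_ using (_<_)
  open Extrema O using (argmax; f[⊥]≤f[argmax]; f[xs]≤f[argmax]; argmax-all)
  open FiniteReachability _≟_ _⟶?_

  <-stable : ∀ {u v} → Stable (u < v)
  <-stable {u} {v} ¬¬u<v with total u v
  ... | inj₁ u≤v = u≤v , λ u≈v → ¬¬u<v λ (_ , u≉v) → u≉v u≈v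
  ... | inj₂ v≤u = ⊥-elim (¬¬u<v λ (u≤v , u≉v) → u≉v (antisym u≤v v≤u))

  ≤-<-trans : ∀ {u v z} → u ≤ v → v < z → u < z
  ≤-<-trans = NonStrictToStrict.≤-<-trans _≈_ _≤_ trans antisym ≤-respˡ-≈

  Below : Pred A _
  Below X = Q X × w X < K

  Edge : Rel A _
  Edge X Y = Below X × Below Y × X ⟶ Y

  Within⇒Edge : ∀ {L X Y} → All Below L → Below X → Star (Within L) X Y → Star Edge X Y
  Within⇒Edge below-L below-X ε = ε
  Within⇒Edge below-L below-X ((X⟶Z , Z∈L) ◅ p) =
    (below-X , All.lookup below-L Z∈L , X⟶Z) ◅ Within⇒Edge below-L (All.lookup below-L Z∈L) p

  Edge⇒Within : ∀ {L} → (∀ {Y} → Below Y → Y ∈ L) → Star Edge ⇒ Star (Within L)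
  Edge⇒Within below⇒∈L = Star.map λ (_ , below-Y , X⟶Y) → X⟶Y , below⇒∈L below-Y

  Covers : List A → Set _
  Covers F = ∀ {Y} → Below Y → Y ∈ F ⊎ All (λ Z → w Z ≤ w Y) F

  module _ {s t} (below-s : Below s) (below-t : Below t) (¬¬s⇝t : ¬ ¬ Star Edge s t) where

    ¬¬Within : ∀ {L} → (∀ {Y} → Below Y → Y ∈ L) → ¬ ¬ Star (Within L) s t
    ¬¬Within below⇒∈L ¬s⇝t = ¬¬s⇝t (¬s⇝t ∘ Edge⇒Within below⇒∈L)

    mutual
      descend : ∀ F → Acc (ℕ._<_ on length) F → All Q F → Covers F →
                Star (Within (t ∷ F)) s t → Star Edge s t
      descend []      _   _  _     s⇝t = Within⇒Edge (below-t ∷ []) below-s s⇝t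
      descend (Z ∷ F) rec QF cover s⇝t =
        descend-from (argmax w Z F)
          (argmax-all w (here refl) (All.tabulate there))
          (f[⊥]≤f[argmax] {f = w} Z F ∷ f[xs]≤f[argmax] {f = w} Z F)
          rec QF cover s⇝t

      descend-from : ∀ {F} M → M ∈ F → All (λ Z → w Z ≤ w M) F →
                     Acc (ℕ._<_ on length) F → All Q F → Covers F →
                     Star (Within (t ∷ F)) s t → Star Edge s t
      descend-from {F} M M∈F heaviest (acc rs) QF cover s⇝t with reachable? (t ∷ F ∖ M) s t
      ... | yes s⇝t′ = descend (F ∖ M) (rs (∖-shorter M∈F)) (filter⁺ _ QF) cover′ s⇝t′
        where
        cover′ : Covers (F ∖ M)
        cover′ {Y} below-Y with cover below-Y
        ... | inj₂ lighter = inj₂ (filter⁺ _ lighter)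
        ... | inj₁ Y∈F with Y ≟ M
        ...   | yes refl = inj₂ (filter⁺ _ heaviest)
        ...   | no Y≢M   = inj₁ (∈-filter⁺ (λ Z → ¬? (Z ≟ M)) Y∈F Y≢M)
      ... | no ¬s⇝t′ = Within⇒Edge (below-t ∷ All.tabulate below-F) below-s s⇝t
        where
        below⇒∈F∖M : ¬ w M < K → ∀ {Y} → Below Y → Y ∈ t ∷ F ∖ M
        below⇒∈F∖M M≮K {Y} below-Y with cover below-Y
        ... | inj₂ lighter = ⊥-elim (M≮K (≤-<-trans (All.lookup lighter M∈F) (proj₂ below-Y)))
        ... | inj₁ Y∈F with Y ≟ M
        ...   | yes refl = ⊥-elim (M≮K (proj₂ below-Y))
        ...   | no Y≢M   = there (∈-filter⁺ (λ Z → ¬? (Z ≟ M)) Y∈F Y≢M)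

        M<K : w M < K
        M<K = <-stable λ M≮K → ¬¬Within (below⇒∈F∖M M≮K) ¬s⇝t′

        below-F : ∀ {Z} → Z ∈ F → Below Z
        below-F Z∈F = All.lookup QF Z∈F , ≤-<-trans (All.lookup heaviest Z∈F) M<K

  Star-stable : ∀ (enum : List A) → (∀ X → X ∈ enum) → ∀ {s t} →
                Below s → Below t → Stable (Star Edge s t)
  Star-stable enum complete below-s below-t ¬¬s⇝t =
    descend below-s below-t ¬¬s⇝t candidates (wellFounded length <-wellFounded candidates)
      (all-filter Q? enum) (inj₁ ∘ ∈candidates)
      (decidable-stable (reachable? _ _ _) (¬¬Within below-s below-t ¬¬s⇝t (there ∘ ∈candidates)))
    where
    candidates : List A
    candidates = filter Q? enum

    ∈candidates : ∀ {Y} → Below Y → Y ∈ candidates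
    ∈candidates (QY , _) = ∈-filter⁺ Q? (complete _) QY

module _ {n : ℕ} where
  open import Data.Fin.Subset using (_∈_; _∉_; _⊆_)

  HasSideIn : Subset n → Subset n → Set
  HasSideIn T D = T ⊆ D ⊎ ∁ T ⊆ D

  ∩-empty⇒⊆∁ : ∀ {p q : Subset n} → ¬ Nonempty (p ∩ q) → p ⊆ ∁ q
  ∩-empty⇒⊆∁ p∩q=∅ i∈p = x∉p⇒x∈∁p λ i∈q → p∩q=∅ (_ , x∈p∩q⁺ (i∈p , i∈q))

  ⊆∁∁⇒⊆ : ∀ {p q : Subset n} → p ⊆ ∁ (∁ q) → p ⊆ q
  ⊆∁∁⇒⊆ p⊆∁∁q = x∉∁p⇒x∈p ∘ x∈∁p⇒x∉p ∘ p⊆∁∁q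

  ∁[∪]-empty⇒∁⊆ : ∀ {p q : Subset n} → ¬ Nonempty (∁ (p ∪ q)) → ∁ p ⊆ q
  ∁[∪]-empty⇒∁⊆ {p} {q} ∁[p∪q]=∅ i∈∁p = x∉∁p⇒x∈p λ i∈∁q →
    ∁[p∪q]=∅ (_ , x∉p⇒x∈∁p ([ x∈∁p⇒x∉p i∈∁p , x∈∁p⇒x∉p i∈∁q ]′ ∘ x∈p∪q⁻ p q))

  x∈∁[p∪q]⁻ : ∀ {p q : Subset n} {i} → i ∈ ∁ (p ∪ q) → i ∈ ∁ p × i ∈ ∁ q
  x∈∁[p∪q]⁻ i∈∁[p∪q] = x∉p⇒x∈∁p (i∉p∪q ∘ x∈p∪q⁺ ∘ inj₁) , x∉p⇒x∈∁p (i∉p∪q ∘ x∈p∪q⁺ ∘ inj₂)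
    where i∉p∪q = x∈∁p⇒x∉p i∈∁[p∪q]

  HasSideIn-∁ : ∀ {T D : Subset n} → HasSideIn (∁ T) D → HasSideIn T D
  HasSideIn-∁ (inj₁ ∁T⊆D)  = inj₂ ∁T⊆D
  HasSideIn-∁ (inj₂ ∁∁T⊆D) = inj₁ (∁∁T⊆D ∘ x∉p⇒x∈∁p ∘ x∈p⇒x∉∁p)

  HasSideIn⇒unseparated : ∀ {T D : Subset n} {u v} → HasSideIn T D → u ∉ D → v ∉ D → u ∈ T → v ∈ T
  HasSideIn⇒unseparated (inj₁ T⊆D)  u∉D v∉D u∈T = ⊥-elim (u∉D (T⊆D u∈T))
  HasSideIn⇒unseparated (inj₂ ∁T⊆D) u∉D v∉D u∈T = x∉∁p⇒x∈p (v∉D ∘ ∁T⊆D)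

module _ {c ℓ₁ ℓ₂ : Level} (R : OrderedCommRing c ℓ₁ ℓ₂) {n m : ℕ}
         (end₁ end₂ : Fin m → Fin n) (x : Fin m → OrderedCommRing.Carrier R) where
  open import Data.Fin.Subset using (_∈_; _∉_)

  isCut? : U.Decidable (IsCut R end₁ end₂ x)
  isCut? S = nonempty? S ×-dec nonempty? (∁ S)

  cross? : Decidable (Cross R end₁ end₂ x)
  cross? A B = nonempty? (A ∩ B) ×-dec nonempty? (A ∩ ∁ B)
         ×-dec nonempty? (B ∩ ∁ A) ×-dec nonempty? (∁ (A ∪ B))

  ¬Cross⇒HasSideIn : ∀ {T B} → ¬ Cross R end₁ end₂ x T B → HasSideIn T B ⊎ HasSideIn T (∁ B)
  ¬Cross⇒HasSideIn {T} {B} T⋔̸B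
    with nonempty? (T ∩ B) | nonempty? (T ∩ ∁ B) | nonempty? (B ∩ ∁ T) | nonempty? (∁ (T ∪ B))
  ... | no T∩B=∅ | _ | _ | _ = inj₂ (inj₁ (∩-empty⇒⊆∁ T∩B=∅))
  ... | _ | no T∩∁B=∅ | _ | _ = inj₁ (inj₁ (⊆∁∁⇒⊆ (∩-empty⇒⊆∁ T∩∁B=∅)))
  ... | _ | _ | no B∩∁T=∅ | _ = inj₂ (inj₂ (p⊆q⇒∁p⊇∁q (⊆∁∁⇒⊆ (∩-empty⇒⊆∁ B∩∁T=∅))))
  ... | _ | _ | _ | no ∁[T∪B]=∅ = inj₁ (inj₂ (∁[∪]-empty⇒∁⊆ ∁[T∪B]=∅))
  ... | yes a | yes b | yes c | yes d = ⊥-elim (T⋔̸B (a , b , c , d))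

  HasSideIn⇒¬Cross : ∀ {T T′ D E} → (∀ {i} → i ∈ D → i ∉ E) →
    HasSideIn T D → HasSideIn T′ E → ¬ Cross R end₁ end₂ x T T′
  HasSideIn⇒¬Cross {T} {T′} D∩E=∅ T-side T′-side
    ((_ , i∈T∩T′) , (_ , j∈T∩∁T′) , (_ , k∈T′∩∁T) , (_ , l∈∁[T∪T′])) with T-side | T′-side
  ... | inj₁ T⊆D  | inj₁ T′⊆E  = let i∈T , i∈T′ = x∈p∩q⁻ T T′ i∈T∩T′
                                 in D∩E=∅ (T⊆D i∈T) (T′⊆E i∈T′)
  ... | inj₁ T⊆D  | inj₂ ∁T′⊆E = let j∈T , j∈∁T′ = x∈p∩q⁻ T (∁ T′) j∈T∩∁T′
                                 in D∩E=∅ (T⊆D j∈T) (∁T′⊆E j∈∁T′)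
  ... | inj₂ ∁T⊆D | inj₁ T′⊆E  = let k∈T′ , k∈∁T = x∈p∩q⁻ T′ (∁ T) k∈T′∩∁T
                                 in D∩E=∅ (∁T⊆D k∈∁T) (T′⊆E k∈T′)
  ... | inj₂ ∁T⊆D | inj₂ ∁T′⊆E = let l∈∁T , l∈∁T′ = x∈∁[p∪q]⁻ l∈∁[T∪T′]
                                 in D∩E=∅ (∁T⊆D l∈∁T) (∁T′⊆E l∈∁T′)

  module _ (η : OrderedCommRing.Carrier R) (S₀ : Subset n) where

    private
      _⇝_ : Subset n → Subset n → Set _
      _⇝_ = Star (CrossEdge R end₁ end₂ x η)

    HasSideIn-component : ∀ {D E} → (∀ {i} → i ∈ D → i ∉ E) →
      (∀ {T} → S₀ ⇝ T → HasSideIn T D ⊎ HasSideIn T E) →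
      HasSideIn S₀ D → ∀ {T} → S₀ ⇝ T → HasSideIn T D
    HasSideIn-component D∩E=∅ sided S₀-side =
      Star-invariant S₀-side λ S₀⇝X X⇒Y@(_ , _ , X⋔Y) X-side →
        [ id , (λ Y-side → ⊥-elim (HasSideIn⇒¬Cross D∩E=∅ X-side Y-side X⋔Y)) ]′
          (sided (S₀⇝X ◅◅ X⇒Y ◅ ε))

    HasSideIn⇒SameAtom : ∀ {D u v} → (∀ {T} → S₀ ⇝ T → HasSideIn T D) → u ∉ D → v ∉ D →
      SameAtom R end₁ end₂ x η S₀ u v
    HasSideIn⇒SameAtom sides u∉D v∉D T T∈𝒞 =
      HasSideIn⇒unseparated side u∉D v∉D , HasSideIn⇒unseparated side v∉D u∉D
      where side = [ sides , HasSideIn-∁ ∘ sides ]′ T∈𝒞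

    uncrossed⇒side-in-atom : ∀ {B} → (∀ {T} → S₀ ⇝ T → ¬ Cross R end₁ end₂ x T B) →
      (∀ {u v} → u ∈ B → v ∈ B → SameAtom R end₁ end₂ x η S₀ u v) ⊎
      (∀ {u v} → u ∈ ∁ B → v ∈ ∁ B → SameAtom R end₁ end₂ x η S₀ u v)
    uncrossed⇒side-in-atom uncrossed with ¬Cross⇒HasSideIn (uncrossed ε)
    ... | inj₁ S₀-side = inj₂ λ u∈∁B v∈∁B → HasSideIn⇒SameAtom
            (HasSideIn-component x∈p⇒x∉∁p (¬Cross⇒HasSideIn ∘ uncrossed) S₀-side)
            (x∈∁p⇒x∉p u∈∁B) (x∈∁p⇒x∉p v∈∁B)
    ... | inj₂ S₀-side = inj₁ λ u∈B v∈B → HasSideIn⇒SameAtom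
            (HasSideIn-component x∈∁p⇒x∉p (swap ∘ ¬Cross⇒HasSideIn ∘ uncrossed) S₀-side)
            (x∈p⇒x∉∁p u∈B) (x∈p⇒x∉∁p v∈B)

    ¬¬reachable : ∀ {B} → NearMin R end₁ end₂ x η S₀ → NearMin R end₁ end₂ x η B →
      AtLeastTwoAtomsIn R end₁ end₂ x η S₀ B → AtLeastTwoAtomsIn R end₁ end₂ x η S₀ (∁ B) →
      ¬ ¬ S₀ ⇝ B
    ¬¬reachable S₀-near B-near (_ , _ , u∈B , v∈B , B-split) (_ , _ , u∈∁B , v∈∁B , ∁B-split) S₀⇝̸B =
      [ (λ same → B-split (same u∈B v∈B)) , (λ same → ∁B-split (same u∈∁B v∈∁B)) ]′
        (uncrossed⇒side-in-atom uncrossed)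
      where
      uncrossed : ∀ {T} → S₀ ⇝ T → ¬ Cross R end₁ end₂ x T _
      uncrossed S₀⇝T T⋔B = S₀⇝̸B (S₀⇝T ◅◅ (near S₀⇝T , B-near , T⋔B) ◅ ε)
        where near = Star-invariant S₀-near λ _ (_ , Y-near , _) _ → Y-near

module _ where
  open import Data.List.Membership.Propositional using (_∈_)

  allSubsets : ∀ n → List (Subset n)
  allSubsets ℕ.zero    = [ Vec.[] ]
  allSubsets (ℕ.suc n) = map (inside Vec.∷_) (allSubsets n)
                      ++ map (outside Vec.∷_) (allSubsets n)

  ∈-allSubsets : ∀ {n} (p : Subset n) → p ∈ allSubsets n
  ∈-allSubsets Vec.[]             = here refl
  ∈-allSubsets (inside Vec.∷ p)  = ∈-++⁺ˡ (∈-map⁺ (inside Vec.∷_) (∈-allSubsets p))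
  ∈-allSubsets (outside Vec.∷ p) = ∈-++⁺ʳ _ (∈-map⁺ (outside Vec.∷_) (∈-allSubsets p))

lemma4p6 : {c ℓ₁ ℓ₂ : Level} (R : OrderedCommRing c ℓ₁ ℓ₂) →
    let open OrderedCommRing R in
    (n m : ℕ) (end₁ end₂ : Fin m → Fin n) (x : Fin m → Carrier) →
    (∀ e → 0# ≤ x e) →
    FractionallyTwoEdgeConnected R end₁ end₂ x →
    (η : Carrier) → 0# < η →
    (S₀ : Subset n) → NearMin R end₁ end₂ x η S₀ →
    (B : Subset n) →
    UnionOfAtoms R end₁ end₂ x η S₀ B →
    NearMin R end₁ end₂ x η B →
    AtLeastTwoAtomsIn R end₁ end₂ x η S₀ B →
    AtLeastTwoAtomsIn R end₁ end₂ x η S₀ (∁ B) →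
    InComponent R end₁ end₂ x η S₀ B
lemma4p6 R n m end₁ end₂ x _ _ η _ S₀ S₀-near B _ B-near B-atoms ∁B-atoms =
  inj₁ (Star-stable (allSubsets n) ∈-allSubsets S₀-near B-near
         (¬¬reachable R end₁ end₂ x η S₀ S₀-near B-near B-atoms ∁B-atoms))
  where
  open OrderedCommRing R using (Carrier; _≈_; _≤_; isTotalOrder; _+_; 2#)
  weights : TotalOrder _ _ _
  weights = record { Carrier = Carrier ; _≈_ = _≈_ ; _≤_ = _≤_ ; isTotalOrder = isTotalOrder }
  open SublevelReachability weights (≡-dec _≟ᴮ_) (cross? R end₁ end₂ x) (isCut? R end₁ end₂ x)
         (cutWeight R end₁ end₂ x) (2# + η)
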